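{- Let $G$ be a bipartite graph and $M$ a matching of $G$, let $C$ be an $M$-cycle or an $M$-path of $G$, and let $x$ and $y$ be two vertices of $G-V(C)$ lying in different partite sets of $G$. (1) If $C$ is a cycle and $e_G(\{x,y\},V(C))\ge \frac{|C|}{2}+1$, then there is an edge $uv\in E(C)\setminus M$ with $e_G(\{x,y\},\{u,v\})=2$. (2) If $C$ is a path and $e_G(\{x,y\},V(C))\ge \frac{|C|}{2}+2$, then there is an edge $uv\in E(C)\setminus M$ with $e_G(\{x,y\},\{u,v\})=2$.
   Context: Graphs are finite and simple. For a matching $M$, an $M$-cycle is a cycle $C$ with $|E(C)\cap M|=|C|/2$; an $M$-path is a path whose edges alternate between $M$ and non-$M$ edges, starting and ending with edges of $M$. $|C|$ denotes the number of vertices. For disjoint vertex sets $S,T$, $e_G(S,T)$ is the number of edges of $G$ between $S$ and $T$. -}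

module Defs where

open import Data.Nat using (ℕ; zero; suc; _+_; _*_; _≤_; _%_)
open import Data.Nat.DivMod using (_mod_)
open import Data.Bool using (Bool; true; false; if_then_else_; not)
open import Data.Fin using (Fin; toℕ; inject₁) renaming (suc to fsuc)
open import Data.List using (map; allFin)
open import Data.Nat.ListAction using (sum)
open import Data.Product using (_×_; Σ; ∃; _,_)
open import Relation.Binary.PropositionalEquality using (_≡_; _≢_)
open import Relation.Nullary using (¬_)

record Graph (n : ℕ) : Set where
  field
    adj   : Fin n → Fin n → Bool
    sym   : ∀ u v → adj u v ≡ adj v u
    irref : ∀ u → adj u u ≡ false
open Graph public

_~[_]_ : ∀ {n} → Fin n → Graph n → Fin n → Set
u ~[ G ] v = adj G u v ≡ true

IsBipartition : ∀ {n} → Graph n → (Fin n → Bool) → Set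
IsBipartition {n} G side = ∀ (u v : Fin n) → u ~[ G ] v → side u ≢ side v

IsMatching : ∀ {n} → Graph n → (Fin n → Fin n → Bool) → Set
IsMatching {n} G M =
  (∀ u v → M u v ≡ M v u) ×
  (∀ u v → M u v ≡ true → u ~[ G ] v) ×
  (∀ u v w → M u v ≡ true → M u w ≡ true → v ≡ w)

𝟙 : Bool → ℕ
𝟙 true  = 1
𝟙 false = 0

ΣFin : ∀ k → (Fin k → ℕ) → ℕ
ΣFin k f = sum (map f (allFin k))

Injective : ∀ {k n} → (Fin k → Fin n) → Set
Injective {k} c = ∀ (i j : Fin k) → c i ≡ c j → i ≡ j

next : ∀ {m} → Fin (suc m) → Fin (suc m)
next {m} i = suc (toℕ i) mod (suc m)

-- c : Fin (suc m) → V is a cycle of G (with |C| = suc m ≥ 3 vertices c 0, …, c m,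
-- edges c i c (i+1 mod |C|)).
IsCycle : ∀ {n} → Graph n → (m : ℕ) → (Fin (suc m) → Fin n) → Set
IsCycle G m c = (2 ≤ m) × Injective c × (∀ i → c i ~[ G ] c (next i))

cycleMEdges : ∀ {n} m → (Fin n → Fin n → Bool) → (Fin (suc m) → Fin n) → ℕ
cycleMEdges m M c = ΣFin (suc m) (λ i → 𝟙 (M (c i) (c (next i))))

-- An M-cycle: a cycle C with |E(C) ∩ M| = |C|/2 (stated as 2·|E(C)∩M| = |C|).
IsMCycle : ∀ {n} → Graph n → (Fin n → Fin n → Bool) → (m : ℕ) → (Fin (suc m) → Fin n) → Set
IsMCycle G M m c = IsCycle G m c × (2 * cycleMEdges m M c ≡ suc m)

IsPath : ∀ {n} → Graph n → (m : ℕ) → (Fin (suc m) → Fin n) → Set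
IsPath G m p = Injective p × (∀ (i : Fin m) → p (inject₁ i) ~[ G ] p (fsuc i))

isEven : ℕ → Bool
isEven zero = true
isEven (suc k) = not (isEven k)

-- An M-path: a path whose edges alternate between M and non-M edges, starting and ending
-- with M-edges: edge i is in M iff i is even, and there is at least one edge with the last
-- edge (index m-1) in M, i.e. m is odd.
IsMPath : ∀ {n} → Graph n → (Fin n → Fin n → Bool) → (m : ℕ) → (Fin (suc m) → Fin n) → Set
IsMPath G M m p =
  IsPath G m p ×
  (∀ (i : Fin m) → M (p (inject₁ i)) (p (fsuc i)) ≡ isEven (toℕ i)) ×
  (isEven m ≡ false)

eXY : ∀ {n} → Graph n → Fin n → Fin n → Fin n → ℕ
eXY G x y w = 𝟙 (adj G x w) + 𝟙 (adj G y w)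

eXYSet : ∀ {n} k → Graph n → Fin n → Fin n → (Fin k → Fin n) → ℕ
eXYSet k G x y c = ΣFin k (λ i → eXY G x y (c i))

Avoids : ∀ {n k} → Fin n → (Fin k → Fin n) → Set
Avoids x c = ∀ i → c i ≢ x

module Submission where

-- Since x and y lie on different sides of a bipartition, no vertex is adjacent
-- to both of them, so every vertex w has weight e({x,y},{w}) ≤ 1.  Whether C has a non-M edge
-- whose two ends both have weight 1 is decidable (a search over the finitely many edges of C);
-- if no such edge exists, every non-M edge of C has total weight ≤ 1, and a counting argument
-- bounds e({x,y},V(C)) below the hypothesis:
--   * cycle: no two consecutive edges of C lie in M (M is a matching and |C| ≥ 3), so every
--     vertex can be charged to a non-M edge of C incident with it, each non-M edge receiving
--     at most one unit (`cyclic-charging`); hence 2·e({x,y},V(C)) ≤ 2·|E(C) ∖ M| = |C|;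
--   * path: the inner vertices split into the non-M edges p₁p₂, p₃p₄, …, while the two ends
--     have weight ≤ 1 each (`alternating-path-bound`); hence 2·e({x,y},V(P)) ≤ |P| + 2.
-- The file first develops finite sums over Fin, the cyclic successor `next`, and the two
-- purely numerical counting lemmas; the graph-theoretic facts come next, then the two parts
-- of the lemma, and finally lemma3 as their conjunction.

open import Defs hiding (sym)
open import Data.Nat using (ℕ; zero; suc; _+_; _*_; _≤_; _%_; z≤n; s≤s; s≤s⁻¹)
open import Data.Nat.Properties
  using ( +-0-commutativeMonoid; +-comm; +-identityʳ; +-mono-≤; +-monoˡ-≤; +-monoʳ-≤
        ; *-monoʳ-≤; +-cancelʳ-≡; ≤-reflexive; ≤-trans; ≤∧≢⇒<; m+1+n≰m; module ≤-Reasoning )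
import Data.Nat.Properties as ℕ using (_≟_)
open import Data.Nat.DivMod using (m%n<n; n%n≡0; m<n⇒m%n≡m)
import Data.Nat.ListAction as List using (sum)
open import Data.Nat.Tactic.RingSolver using (solve-∀)
open import Algebra.Properties.CommutativeMonoid.Sum +-0-commutativeMonoid
  using (sum-syntax; ∑-distrib-+; sum-cong-≗; sum-init-last)
open import Data.Bool using (Bool; true; false; not)
open import Data.Bool.Properties using (not-involutive; ¬-not)
import Data.Bool.Properties as Bool using (_≟_)
open import Data.Fin using (Fin; toℕ; fromℕ; inject₁) renaming (zero to fzero; suc to fsuc)
open import Data.Fin.Properties using (toℕ-injective; toℕ-inject₁; toℕ-fromℕ; toℕ-fromℕ<; toℕ<n; any?)
open import Data.Fin.Relation.Unary.Top using (view; ‵fromℕ; ‵inj₁)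
open import Data.List using (tabulate)
open import Data.List.Properties using (map-tabulate)
open import Data.Product using (_×_; Σ; _,_)
open import Data.Empty using (⊥; ⊥-elim)
open import Relation.Nullary using (yes; no)
open import Relation.Nullary.Decidable using (_×-dec_)
open import Relation.Binary.PropositionalEquality

ΣFin≡∑ : ∀ k (f : Fin k → ℕ) → ΣFin k f ≡ ∑[ i < k ] f i
ΣFin≡∑ k f = trans (cong List.sum (map-tabulate (λ i → i) f)) (sum-tabulate k f)
  where
  sum-tabulate : ∀ k (f : Fin k → ℕ) → List.sum (tabulate f) ≡ ∑[ i < k ] f i
  sum-tabulate zero    f = refl
  sum-tabulate (suc k) f = cong (f fzero +_) (sum-tabulate k (λ i → f (fsuc i)))

∑-mono-≤ : ∀ k {f g : Fin k → ℕ} → (∀ i → f i ≤ g i) → ∑[ i < k ] f i ≤ ∑[ i < k ] g i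
∑-mono-≤ zero    f≤g = z≤n
∑-mono-≤ (suc k) f≤g = +-mono-≤ (f≤g fzero) (∑-mono-≤ k (λ i → f≤g (fsuc i)))

∑-ones : ∀ k → ∑[ i < k ] 1 ≡ k
∑-ones zero    = refl
∑-ones (suc k) = cong suc (∑-ones k)

count-true+false : ∀ k (b : Fin k → Bool) → ∑[ i < k ] 𝟙 (not (b i)) + ∑[ i < k ] 𝟙 (b i) ≡ k
count-true+false k b = begin
  ∑[ i < k ] 𝟙 (not (b i)) + ∑[ i < k ] 𝟙 (b i) ≡⟨ sym (∑-distrib-+ (λ i → 𝟙 (not (b i))) (λ i → 𝟙 (b i))) ⟩
  ∑[ i < k ] (𝟙 (not (b i)) + 𝟙 (b i))           ≡⟨ sum-cong-≗ (λ i → 𝟙-not+𝟙 (b i)) ⟩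
  ∑[ i < k ] 1                                   ≡⟨ ∑-ones k ⟩
  k                                              ∎
  where
  open ≡-Reasoning
  𝟙-not+𝟙 : ∀ b → 𝟙 (not b) + 𝟙 b ≡ 1
  𝟙-not+𝟙 true  = refl
  𝟙-not+𝟙 false = refl

half-false : ∀ k (b : Fin k → Bool) →
  2 * ∑[ i < k ] 𝟙 (b i) ≡ k → 2 * ∑[ i < k ] 𝟙 (not (b i)) ≡ k
half-false k b 2T≡k = trans (cong (2 *_) F≡T) 2T≡k
  where
  F T : ℕ
  F = ∑[ i < k ] 𝟙 (not (b i))
  T = ∑[ i < k ] 𝟙 (b i)
  F≡T : F ≡ T
  F≡T = +-cancelʳ-≡ T F T (trans (count-true+false k b)
          (trans (sym 2T≡k) (cong (T +_) (+-identityʳ T))))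

toℕ-next : ∀ {m} (i : Fin (suc m)) → toℕ (next i) ≡ suc (toℕ i) % suc m
toℕ-next {m} i = toℕ-fromℕ< (m%n<n (suc (toℕ i)) (suc m))

next-inject₁ : ∀ {m} (i : Fin m) → next (inject₁ i) ≡ fsuc i
next-inject₁ {m} i = toℕ-injective (begin
  toℕ (next (inject₁ i))        ≡⟨ toℕ-next (inject₁ i) ⟩
  suc (toℕ (inject₁ i)) % suc m ≡⟨ cong (λ k → suc k % suc m) (toℕ-inject₁ i) ⟩
  suc (toℕ i) % suc m           ≡⟨ m<n⇒m%n≡m (s≤s (toℕ<n i)) ⟩
  suc (toℕ i)                   ∎)
  where open ≡-Reasoning

next-last : ∀ m → next (fromℕ m) ≡ fzero
next-last m = toℕ-injective (begin
  toℕ (next (fromℕ m))        ≡⟨ toℕ-next (fromℕ m) ⟩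
  suc (toℕ (fromℕ m)) % suc m ≡⟨ cong (λ k → suc k % suc m) (toℕ-fromℕ m) ⟩
  suc m % suc m               ≡⟨ n%n≡0 (suc m) ⟩
  0                           ∎)
  where open ≡-Reasoning

∑-rotate : ∀ m (f : Fin (suc m) → ℕ) → ∑[ j < suc m ] f (next j) ≡ ∑[ j < suc m ] f j
∑-rotate m f = begin
  ∑[ j < suc m ] f (next j)                                  ≡⟨ sum-init-last (λ j → f (next j)) ⟩
  ∑[ i < m ] f (next (inject₁ i)) + f (next (fromℕ m))
    ≡⟨ cong₂ _+_ (sum-cong-≗ (λ i → cong f (next-inject₁ i))) (cong f (next-last m)) ⟩
  ∑[ i < m ] f (fsuc i) + f fzero                            ≡⟨ +-comm _ (f fzero) ⟩
  ∑[ j < suc m ] f j                                         ∎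
  where open ≡-Reasoning

-- Cases: j is
-- the last index (two steps lead to 1), the last but one (two steps lead to 0), or neither
-- (two steps lead to j + 2).
next²≢id : ∀ {m} (j : Fin (3 + m)) → next (next j) ≢ j
next²≢id {m} j eq with view j
... | ‵fromℕ = one≢last (begin
  fsuc fzero                  ≡⟨ sym (next-inject₁ fzero) ⟩
  next fzero                  ≡⟨ cong next (sym (next-last (2 + m))) ⟩
  next (next (fromℕ (2 + m))) ≡⟨ eq ⟩
  fromℕ (2 + m)               ∎)
  where
  open ≡-Reasoning
  one≢last : fsuc fzero ≢ fromℕ (2 + m)
  one≢last ()
... | ‵inj₁ {i = i} _ with view i
...   | ‵fromℕ = zero≢inner (trans (sym (trans (cong next (next-inject₁ i)) (next-last (2 + m)))) eq)
  where
  zero≢inner : fzero ≢ inject₁ (fromℕ (1 + m))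
  zero≢inner ()
...   | ‵inj₁ {i = k} _ = two-steps-ahead (begin
  fsuc (fsuc k)                     ≡⟨ sym (next-inject₁ (fsuc k)) ⟩
  next (inject₁ (fsuc k))           ≡⟨ cong next (sym (next-inject₁ (inject₁ k))) ⟩
  next (next (inject₁ (inject₁ k))) ≡⟨ eq ⟩
  inject₁ (inject₁ k)               ∎)
  where
  open ≡-Reasoning
  two-steps-ahead : fsuc (fsuc k) ≢ inject₁ (inject₁ k)
  two-steps-ahead e = m+1+n≰m (toℕ k) (≤-reflexive (begin
    toℕ k + 2                 ≡⟨ +-comm (toℕ k) 2 ⟩
    toℕ (fsuc (fsuc k))       ≡⟨ cong toℕ e ⟩
    toℕ (inject₁ (inject₁ k)) ≡⟨ toℕ-inject₁ (inject₁ k) ⟩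
    toℕ (inject₁ k)           ≡⟨ toℕ-inject₁ k ⟩
    toℕ k                     ∎))

-- Positions j carry weights a j ≤ 1, steps j → next j carry
-- labels b j, and no two consecutive steps are labelled true.  If every false step has total
-- end-weight ≤ 1, the total weight is at most the number of false steps: position j is charged
-- to step j if b j is false, and otherwise to the preceding step, which is then false.
cyclic-charging : ∀ m (a : Fin (suc m) → ℕ) (b : Fin (suc m) → Bool) →
  (∀ j → a j ≤ 1) →
  (∀ j → b j ≡ true → b (next j) ≡ true → ⊥) →
  (∀ j → b j ≡ false → a j + a (next j) ≤ 1) →
  ∑[ j < suc m ] a j ≤ ∑[ j < suc m ] 𝟙 (not (b j))
cyclic-charging m a b a≤1 no-true-pair false-step≤1 = begin
  ∑[ j < suc m ] a j                              ≡⟨ sum-cong-≗ split ⟨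
  ∑[ j < suc m ] (own j + passed-back j)          ≡⟨ ∑-distrib-+ own passed-back ⟩
  ∑[ j < suc m ] own j + ∑[ j < suc m ] passed-back j
    ≡⟨ cong (∑[ j < suc m ] own j +_) (∑-rotate m passed-back) ⟨
  ∑[ j < suc m ] own j + ∑[ j < suc m ] passed-back (next j)
    ≡⟨ ∑-distrib-+ own (λ j → passed-back (next j)) ⟨
  ∑[ j < suc m ] (own j + passed-back (next j))  ≤⟨ ∑-mono-≤ (suc m) charge ⟩
  ∑[ j < suc m ] 𝟙 (not (b j))                   ∎
  where
  open ≤-Reasoning
  own passed-back : Fin (suc m) → ℕ
  own j with b j
  ... | true  = 0
  ... | false = a j
  passed-back j with b j
  ... | true  = a j
  ... | false = 0

  split : ∀ j → own j + passed-back j ≡ a j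
  split j with b j
  ... | true  = refl
  ... | false = +-identityʳ (a j)

  charge : ∀ j → own j + passed-back (next j) ≤ 𝟙 (not (b j))
  charge j with b j in bj | b (next j) in bnext
  ... | false | false = ≤-trans (≤-reflexive (+-identityʳ (a j))) (a≤1 j)
  ... | false | true  = false-step≤1 j bj
  ... | true  | false = z≤n
  ... | true  | true  = ⊥-elim (no-true-pair j bj bnext)

-- A path with an odd number m of steps has positions
-- 0, …, m with weights ≤ 1; if every odd-numbered step has total end-weight ≤ 1, the positions
-- 1, …, m-1 pair up along these steps, so 2·Σa ≤ 2·a₀ + (m + 1).
alternating-path-bound : ∀ m (a : Fin (suc m) → ℕ) → isEven m ≡ false → (∀ j → a j ≤ 1) →
  (∀ (i : Fin m) → isEven (toℕ i) ≡ false → a (inject₁ i) + a (fsuc i) ≤ 1) →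
  2 * ∑[ j < suc m ] a j ≤ 2 * a fzero + suc m
alternating-path-bound zero a () a≤1 odd-step≤1
alternating-path-bound 1 a _ a≤1 _ = begin
  2 * (a fzero + (a (fsuc fzero) + 0)) ≡⟨ regroup (a fzero) (a (fsuc fzero)) ⟩
  2 * a fzero + 2 * a (fsuc fzero)     ≤⟨ +-monoʳ-≤ (2 * a fzero) (*-monoʳ-≤ 2 (a≤1 (fsuc fzero))) ⟩
  2 * a fzero + 2                      ∎
  where
  open ≤-Reasoning
  regroup : ∀ u v → 2 * (u + (v + 0)) ≡ 2 * u + 2 * v
  regroup = solve-∀
alternating-path-bound (suc (suc m)) a m-odd a≤1 odd-step≤1 = begin
  2 * (a₀ + (a₁ + ∑[ j < suc m ] rest j))     ≡⟨ regroup₁ a₀ a₁ (∑[ j < suc m ] rest j) ⟩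
  2 * a₀ + 2 * a₁ + 2 * ∑[ j < suc m ] rest j ≤⟨ +-monoʳ-≤ (2 * a₀ + 2 * a₁) rest-bound ⟩
  2 * a₀ + 2 * a₁ + (2 * a₂ + suc m)          ≡⟨ regroup₂ a₀ a₁ a₂ (suc m) ⟩
  2 * a₀ + (2 * (a₁ + a₂) + suc m)
    ≤⟨ +-monoʳ-≤ (2 * a₀) (+-monoˡ-≤ (suc m) (*-monoʳ-≤ 2 (odd-step≤1 (fsuc fzero) refl))) ⟩
  2 * a₀ + (2 * 1 + suc m)                    ∎
  where
  open ≤-Reasoning
  a₀ a₁ a₂ : ℕ
  a₀ = a fzero
  a₁ = a (fsuc fzero)
  a₂ = a (fsuc (fsuc fzero))

  -- The path with its first two positions removed is again alternating with an odd number of steps.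
  rest : Fin (suc m) → ℕ
  rest j = a (fsuc (fsuc j))
  rest-bound : 2 * ∑[ j < suc m ] rest j ≤ 2 * a₂ + suc m
  rest-bound = alternating-path-bound m rest (trans (sym (not-involutive _)) m-odd) (λ j → a≤1 _)
    (λ i i-odd → odd-step≤1 (fsuc (fsuc i)) (trans (not-involutive _) i-odd))

  regroup₁ : ∀ u v s → 2 * (u + (v + s)) ≡ 2 * u + 2 * v + 2 * s
  regroup₁ = solve-∀
  regroup₂ : ∀ u v w k → 2 * u + 2 * v + (2 * w + k) ≡ 2 * u + (2 * (v + w) + k)
  regroup₂ = solve-∀

-- x and y lie on different sides of a bipartition, so no vertex is adjacent to both of them.
weight≤1 : ∀ {n} (G : Graph n) (side : Fin n → Bool) → IsBipartition G side →
  ∀ {x y} → side x ≢ side y → ∀ w → eXY G x y w ≤ 1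
weight≤1 G side bipartite {x} {y} x≁y w with adj G x w in x~w | adj G y w in y~w
... | false | false = z≤n
... | false | true  = ≤-reflexive refl
... | true  | false = ≤-reflexive refl
... | true  | true  =
  ⊥-elim (x≁y (trans (¬-not (bipartite x w x~w)) (sym (¬-not (bipartite y w y~w)))))

light-pair : ∀ {u v} → u ≤ 1 → v ≤ 1 → u + v ≢ 2 → u + v ≤ 1
light-pair u≤1 v≤1 u+v≢2 = s≤s⁻¹ (≤∧≢⇒< (+-mono-≤ u≤1 v≤1) u+v≢2)

-- A matching never contains two consecutive edges of a cycle (which has ≥ 3 vertices): both
-- would contain c (next j), forcing the repetition c j = c (next (next j)).
no-consecutive-M-edges : ∀ {n} (G : Graph n) (M : Fin n → Fin n → Bool) → IsMatching G M →
  ∀ {m} (c : Fin (suc m) → Fin n) → IsCycle G m c →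
  ∀ j → M (c j) (c (next j)) ≡ true → M (c (next j)) (c (next (next j))) ≡ true → ⊥
no-consecutive-M-edges G M (M-sym , _ , M-unique) c (s≤s (s≤s _) , c-injective , _) j jM nextM =
  next²≢id j (sym (c-injective j (next (next j))
    (M-unique (c (next j)) (c j) (c (next (next j))) (trans (M-sym _ _) jM) nextM)))

-- Otherwise every non-M edge is light, and charging gives
-- 2·e({x,y},V(C)) ≤ 2·|E(C) ∖ M| = |C|.
cycle-part : ∀ {n} (G : Graph n) (side : Fin n → Bool) → IsBipartition G side →
  (M : Fin n → Fin n → Bool) → IsMatching G M →
  (x y : Fin n) → side x ≢ side y →
  ∀ (m : ℕ) (c : Fin (suc m) → Fin n) → IsMCycle G M m c →
  suc m + 2 ≤ 2 * eXYSet (suc m) G x y c →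
  Σ (Fin (suc m)) (λ i → (M (c i) (c (next i)) ≡ false) ×
    (eXY G x y (c i) + eXY G x y (c (next i)) ≡ 2))
cycle-part G side bipartite M matching x y x≁y m c (cycle , half-in-M) many-edges
  with any? (λ j → (M (c j) (c (next j)) Bool.≟ false)
              ×-dec (eXY G x y (c j) + eXY G x y (c (next j)) ℕ.≟ 2))
... | yes found = found
... | no none = ⊥-elim (m+1+n≰m (suc m) (≤-trans many-edges (begin
  2 * eXYSet (suc m) G x y c             ≡⟨ cong (2 *_) (ΣFin≡∑ (suc m) a) ⟩
  2 * ∑[ j < suc m ] a j                 ≤⟨ *-monoʳ-≤ 2 charged ⟩
  2 * ∑[ j < suc m ] 𝟙 (not (b j))       ≡⟨ half-false (suc m) b half-in-M′ ⟩
  suc m                                  ∎)))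
  where
  open ≤-Reasoning
  a : Fin (suc m) → ℕ
  a j = eXY G x y (c j)
  b : Fin (suc m) → Bool
  b j = M (c j) (c (next j))
  a≤1 : ∀ j → a j ≤ 1
  a≤1 j = weight≤1 G side bipartite x≁y (c j)
  charged : ∑[ j < suc m ] a j ≤ ∑[ j < suc m ] 𝟙 (not (b j))
  charged = cyclic-charging m a b a≤1 (no-consecutive-M-edges G M matching c cycle)
    (λ j bj → light-pair (a≤1 j) (a≤1 (next j)) (λ heavy → none (j , bj , heavy)))
  half-in-M′ : 2 * ∑[ j < suc m ] 𝟙 (b j) ≡ suc m
  half-in-M′ = trans (cong (2 *_) (sym (ΣFin≡∑ (suc m) (λ j → 𝟙 (b j))))) half-in-M

-- Otherwise every non-M edge, i.e. every odd-numbered edge, is light,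
-- and pairing gives 2·e({x,y},V(P)) ≤ 2·1 + |P|.
path-part : ∀ {n} (G : Graph n) (side : Fin n → Bool) → IsBipartition G side →
  (M : Fin n → Fin n → Bool) → (x y : Fin n) → side x ≢ side y →
  ∀ (m : ℕ) (p : Fin (suc m) → Fin n) → IsMPath G M m p →
  suc m + 4 ≤ 2 * eXYSet (suc m) G x y p →
  Σ (Fin m) (λ i → (M (p (inject₁ i)) (p (fsuc i)) ≡ false) ×
    (eXY G x y (p (inject₁ i)) + eXY G x y (p (fsuc i)) ≡ 2))
path-part G side bipartite M x y x≁y m p (_ , alternating , m-odd) many-edges
  with any? (λ i → (M (p (inject₁ i)) (p (fsuc i)) Bool.≟ false)
              ×-dec (eXY G x y (p (inject₁ i)) + eXY G x y (p (fsuc i)) ℕ.≟ 2))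
... | yes found = found
... | no none = ⊥-elim (m+1+n≰m (2 + suc m) (≤-trans (≤-reflexive (regroup m)) (≤-trans many-edges (begin
  2 * eXYSet (suc m) G x y p       ≡⟨ cong (2 *_) (ΣFin≡∑ (suc m) a) ⟩
  2 * ∑[ j < suc m ] a j           ≤⟨ alternating-path-bound m a m-odd a≤1 odd-edge-light ⟩
  2 * a fzero + suc m              ≤⟨ +-monoˡ-≤ (suc m) (*-monoʳ-≤ 2 (a≤1 fzero)) ⟩
  2 + suc m                        ∎))))
  where
  open ≤-Reasoning
  a : Fin (suc m) → ℕ
  a j = eXY G x y (p j)
  a≤1 : ∀ j → a j ≤ 1
  a≤1 j = weight≤1 G side bipartite x≁y (p j)
  -- the odd-numbered edges are exactly the non-M edges of the M-path
  odd-edge-light : ∀ (i : Fin m) → isEven (toℕ i) ≡ false → a (inject₁ i) + a (fsuc i) ≤ 1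
  odd-edge-light i i-odd = light-pair (a≤1 (inject₁ i)) (a≤1 (fsuc i))
    (λ heavy → none (i , trans (alternating i) i-odd , heavy))
  regroup : ∀ k → 2 + suc k + 2 ≡ suc k + 4
  regroup = solve-∀

-- The lemma: part (1) for M-cycles and part (2) for M-paths.
lemma3 : ∀ {n} (G : Graph n) (side : Fin n → Bool) → IsBipartition G side →
    (M : Fin n → Fin n → Bool) → IsMatching G M →
    (x y : Fin n) → side x ≢ side y →
    (∀ (m : ℕ) (c : Fin (suc m) → Fin n) → IsMCycle G M m c →
      Avoids x c → Avoids y c →
      suc m + 2 ≤ 2 * eXYSet (suc m) G x y c →
      Σ (Fin (suc m)) (λ i → (M (c i) (c (next i)) ≡ false) ×
        (eXY G x y (c i) + eXY G x y (c (next i)) ≡ 2)))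
    ×
    (∀ (m : ℕ) (p : Fin (suc m) → Fin n) → IsMPath G M m p →
      Avoids x p → Avoids y p →
      suc m + 4 ≤ 2 * eXYSet (suc m) G x y p →
      Σ (Fin m) (λ i → (M (p (inject₁ i)) (p (fsuc i)) ≡ false) ×
        (eXY G x y (p (inject₁ i)) + eXY G x y (p (fsuc i)) ≡ 2)))
lemma3 G side bipartite M matching x y x≁y =
    (λ m c C _ _ → cycle-part G side bipartite M matching x y x≁y m c C)
  , (λ m p P _ _ → path-part G side bipartite M x y x≁y m p P)
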